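{- Let $2\le k\le n$. Every vertex $\tilde{u}=(u_1,\ldots,u_n)$ of $\Pi_{n-1}(k-1)$ satisfies \[ \{u_1,\ldots,u_n\}=\left\{\binom{n-1}{k-1},\binom{n-2}{k-1},\ldots,\binom{k-1}{k-1},0\right\}, \] with exactly $k-1$ of the $u_i$ equal to $0$ and each nonzero value of this set occurring exactly once among $u_1,\ldots,u_n$. In particular $\Pi_{n-1}(k-1)$ has exactly $\frac{n!}{(k-1)!}$ vertices.
   Context: For $F\subseteq[n]$, $\Delta_F=\{\tilde{x}\in\mathbb{R}^n: x_i\ge0,\ \sum_ix_i=1,\ x_i=0\text{ for }i\notin F\}$; $\Pi_{n-1}(k-1)=\sum_{F\subseteq[n],|F|=k}\Delta_F$ (Minkowski sum).
   Formalization: Stated over ℚ^n instead of ℝ^n: the points of $\Pi_{n-1}(k-1)$, the points of each $\Delta_F$ summed to form them, and the linear functionals exposing vertices all have rational coordinates. -}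

module Defs where

open import Data.Nat as ℕ using (ℕ; zero; suc; _!; _∸_)
open import Data.Nat.Properties using (_!≢0)
open import Data.Integer using (+_)
open import Data.Rational as ℚ using (ℚ; 0ℚ; 1ℚ; _+_; _*_; _≤_; _<_)
open import Data.Rational.Properties using (_≟_)
open import Data.Fin using (Fin)
open import Data.Fin.Subset using (Subset; inside; outside; ∣_∣)
open import Data.Vec as Vec using (Vec; []; _∷_; lookup; zipWith; replicate; toList)
open import Data.List as List using (List; []; _∷_; _++_; filter; length)
open import Data.Product using (Σ; _×_; ∃)
open import Relation.Binary.PropositionalEquality using (_≡_; _≢_)

ℕ→ℚ : ℕ → ℚ
ℕ→ℚ m = (+ m) ℚ./ 1

Point : ℕ → Set
Point n = Vec ℚ n

0ᵥ : ∀ {n} → Point n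
0ᵥ = replicate _ 0ℚ

_+ᵥ_ : ∀ {n} → Point n → Point n → Point n
_+ᵥ_ = zipWith _+_

sumᵥ : ∀ {n} → List (Point n) → Point n
sumᵥ = List.foldr _+ᵥ_ 0ᵥ

sumℚ : List ℚ → ℚ
sumℚ = List.foldr _+_ 0ℚ

dot : ∀ {n} → Point n → Point n → ℚ
dot c x = sumℚ (toList (zipWith _*_ c x))

allSubsets : ∀ n → List (Subset n)
allSubsets zero = [] ∷ []
allSubsets (suc n) = List.map (inside ∷_) (allSubsets n) ++ List.map (outside ∷_) (allSubsets n)

kSubsets : ∀ n k → List (Subset n)
kSubsets n k = filter (λ F → ∣ F ∣ ℕ.≟ k) (allSubsets n)

InSimplex : ∀ {n} → Subset n → Point n → Set
InSimplex {n} F x =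
  ((i : Fin n) → 0ℚ ≤ lookup x i)
  × sumℚ (toList x) ≡ 1ℚ
  × ((i : Fin n) → lookup F i ≡ outside → lookup x i ≡ 0ℚ)

-- x ∈ Π_{n-1}(k-1) = Σ_{F ⊆ [n], |F| = k} Δ_F  (Minkowski sum)
InPi : ∀ n k → Point n → Set
InPi n k x =
  Σ (Subset n → Point n) λ y →
    ((F : Subset n) → ∣ F ∣ ≡ k → InSimplex F (y F))
    × x ≡ sumᵥ (List.map y (kSubsets n k))

IsVertex : ∀ {n} → (Point n → Set) → Point n → Set
IsVertex {n} P u =
  P u × ∃ λ (c : Point n) → (x : Point n) → P x → x ≢ u → dot c x < dot c u

countEq : ∀ {n} → ℚ → Point n → ℕ
countEq v u = length (filter (λ q → q ≟ v) (toList u))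

vertexCount : ℕ → ℕ → ℕ
vertexCount n k = ℕ._/_ (n !) ((k ∸ 1) !) {{(k ∸ 1) !≢0}}

module Submission where

-- Order [n] by a weight vector c, breaking ties by the index. On each simplex Δ_F the functional
-- dot c is maximized at the unit vector of the top element of F, so over the Minkowski sum Π it is
-- maximized at v = Σ_F e (top F), uniquely when the weights are distinct. Coordinate i of v counts
-- the k-subsets with top element i; if i has rank r these are {i} plus k-1 of the r smaller
-- elements, so v_i = C(r, k-1). Thus the vertices of Π are exactly the points (C(π i, k-1))_i for
-- permutations π of [n]: each vertex is some v, and for π itself as weights v is a vertex.
-- Inserting the largest value C(n-1, k-1) at each of the n positions of the vertex list for n-1
-- lists them without repetition, giving n!/(k-1)! of them.

open import Defs
open import Data.Nat using (ℕ; _≤_; _∸_)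
open import Data.Nat.Combinatorics using (_C_)
open import Data.Rational using (0ℚ)
open import Data.Fin using (Fin)
open import Data.Vec using (lookup)
open import Data.List using (List; length)
open import Data.List.Membership.Propositional using (_∈_)
open import Data.List.Relation.Unary.Unique.Propositional using (Unique)
open import Data.Product using (Σ; _×_; ∃)
open import Data.Sum using (_⊎_)
open import Function.Bundles using (_⇔_)
open import Relation.Binary.PropositionalEquality using (_≡_)

open import Level using (0ℓ)
open import Algebra using (CommutativeMonoid)
import Algebra.Properties.CommutativeMonoid.Sum as CommutativeMonoidSum
open import Data.Bool as Bool using (Bool; true; false; _∧_; not; T)
import Data.Bool.Properties as BoolP
open import Data.Nat using (zero; suc; _+_; _*_; _<_; _!; _≡ᵇ_; z≤n; s≤s)
import Data.Nat as ℕ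
import Data.Nat.Properties as ℕP
open import Data.Nat.Combinatorics using (nCk+nC[k+1]≡[n+1]C[k+1]; k>n⇒nCk≡0)
open import Data.Nat.Coprimality using (1-coprimeTo)
import Data.Nat.Coprimality as Coprime
open import Data.Nat.DivMod using (m*n/n≡m)
import Data.Integer as ℤ
import Data.Integer.Properties as ℤP
open import Data.Rational as ℚ using (ℚ; 1ℚ; mkℚ; *<*)
import Data.Rational.Properties as ℚP
open import Algebra.Properties.CommutativeSemigroup (CommutativeMonoid.commutativeSemigroup ℚP.+-0-commutativeMonoid)
  using (interchange)
open import Data.Fin using (zero; suc; toℕ; fromℕ; fromℕ<; punchIn; punchOut)
import Data.Fin as Fin
import Data.Fin.Properties as FinP
open import Data.Fin.Subset using (Subset; inside; outside; ∣_∣)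
open import Data.Fin.Permutation as Perm using (Permutation; _⟨$⟩ʳ_; _⟨$⟩ˡ_; permutation)
open import Data.Vec using (Vec; []; _∷_; toList; tabulate; insertAt; removeAt; _[_]≔_)
import Data.Vec.Properties as VecP
open import Data.List as List using ([]; _∷_; _++_; filter; allFin; cartesianProductWith)
import Data.List.Properties as ListP
open import Data.List.Membership.Propositional using (find)
open import Data.List.Membership.Propositional.Properties
  using (∈-filter⁻; ∈-filter⁺; ∈-allFin; ∈-map⁻; ∈-cartesianProductWith⁺; ∈-cartesianProductWith⁻)
open import Data.List.Relation.Unary.Any using (here; there)
import Data.List.Relation.Unary.All as All
open import Data.List.Relation.Unary.All.Properties using (¬All⇒Any¬)
open import Data.List.Relation.Unary.AllPairs using ([]; _∷_)
open import Data.List.Relation.Unary.Unique.Propositional.Properties using (++⁺; allFin⁺)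
open import Data.Product using (_,_; proj₁; proj₂)
open import Data.Product.Relation.Binary.Lex.Strict using (×-Lex; ×-transitive; ×-compare)
open import Data.Sum using (inj₁; inj₂)
import Data.Sum as Sum
open import Data.Empty using (⊥-elim)
open import Function using (_∘_; id; mk⇔; Equivalence)
open import Function.Construct.Composition using (_⇔-∘_)
open import Function.Construct.Symmetry using (⇔-sym)
open import Relation.Nullary using (Dec; yes; no; does; ¬_; contradiction)
open import Relation.Nullary.Decidable using (dec-false; does-⇔; _×-dec_; ¬?; T?)
open import Relation.Binary
  using (Rel; IsStrictTotalOrder; StrictTotalOrder; DecTotalOrder; tri<; tri≈; tri>; isStrictTotalOrderᶜ)
open import Relation.Binary.PropositionalEquality
  using (_≢_; refl; sym; trans; cong; cong₂; subst; subst₂; isEquivalence; module ≡-Reasoning)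

≤∧≢⇒< : ∀ {p q : ℚ} → p ℚ.≤ q → p ≢ q → p ℚ.< q
≤∧≢⇒< {p} {q} p≤q p≢q with ℚP.<-cmp p q
... | tri< p<q _ _ = p<q
... | tri≈ _ p≡q _ = contradiction p≡q p≢q
... | tri> _ _ q<p = contradiction (ℚP.<-≤-trans q<p p≤q) (ℚP.<-irrefl refl)

private
  ℕ→ℚ≡mkℚ : ∀ m → ℕ→ℚ m ≡ mkℚ (ℤ.+ m) 0 (Coprime.sym (1-coprimeTo m))
  ℕ→ℚ≡mkℚ m = ℚP.normalize-coprime (Coprime.sym (1-coprimeTo m))

ℕ→ℚ-+ : ∀ a b → ℕ→ℚ (a + b) ≡ ℕ→ℚ a ℚ.+ ℕ→ℚ b
ℕ→ℚ-+ a b rewrite ℕ→ℚ≡mkℚ a | ℕ→ℚ≡mkℚ b | ℤP.*-identityʳ (ℤ.+ a) | ℤP.*-identityʳ (ℤ.+ b) = refl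

ℕ→ℚ-mono-< : ∀ {a b} → a < b → ℕ→ℚ a ℚ.< ℕ→ℚ b
ℕ→ℚ-mono-< {a} {b} a<b rewrite ℕ→ℚ≡mkℚ a | ℕ→ℚ≡mkℚ b =
  *<* (subst₂ ℤ._<_ (sym (ℤP.*-identityʳ (ℤ.+ a))) (sym (ℤP.*-identityʳ (ℤ.+ b))) (ℤ.+<+ a<b))

ℕ→ℚ-cancel-< : ∀ {a b} → ℕ→ℚ a ℚ.< ℕ→ℚ b → a < b
ℕ→ℚ-cancel-< {a} {b} p with ℕP.<-cmp a b
... | tri< a<b _ _ = a<b
... | tri≈ _ refl _ = contradiction p (ℚP.<-irrefl refl)
... | tri> _ _ b<a = contradiction p (ℚP.<-asym (ℕ→ℚ-mono-< b<a))

ℕ→ℚ-injective : ∀ {a b} → ℕ→ℚ a ≡ ℕ→ℚ b → a ≡ b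
ℕ→ℚ-injective {a} {b} eq with ℕP.<-cmp a b
... | tri< a<b _ _ = contradiction (ℕ→ℚ-mono-< a<b) (ℚP.<-irrefl eq)
... | tri≈ _ a≡b _ = a≡b
... | tri> _ _ b<a = contradiction (ℕ→ℚ-mono-< b<a) (ℚP.<-irrefl (sym eq))

e : ∀ {n} → Fin n → Point n
e i = 0ᵥ [ i ]≔ 1ℚ

lookup-e-≡ : ∀ {n} (i : Fin n) → lookup (e i) i ≡ 1ℚ
lookup-e-≡ i = VecP.lookup∘update i 0ᵥ 1ℚ

lookup-e-≢ : ∀ {n} {i j : Fin n} → i ≢ j → lookup (e i) j ≡ 0ℚ
lookup-e-≢ {j = j} i≢j = trans (VecP.lookup∘update′ (i≢j ∘ sym) 0ᵥ 1ℚ) (VecP.lookup-replicate j 0ℚ)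

lookup-ext : ∀ {n} {x y : Point n} → (∀ i → lookup x i ≡ lookup y i) → x ≡ y
lookup-ext {x = x} {y} x≗y = begin
  x                   ≡⟨ VecP.tabulate∘lookup x ⟨
  tabulate (lookup x) ≡⟨ VecP.tabulate-cong x≗y ⟩
  tabulate (lookup y) ≡⟨ VecP.tabulate∘lookup y ⟩
  y                   ∎
  where open ≡-Reasoning

lookup-sumᵥ-map : ∀ {A : Set} {n} (y : A → Point n) (L : List A) (i : Fin n) →
                  lookup (sumᵥ (List.map y L)) i ≡ sumℚ (List.map (λ a → lookup (y a) i) L)
lookup-sumᵥ-map y []      i = VecP.lookup-replicate i 0ℚ
lookup-sumᵥ-map y (a ∷ L) i =
  trans (VecP.lookup-zipWith ℚ._+_ i (y a) _) (cong (lookup (y a) i ℚ.+_) (lookup-sumᵥ-map y L i))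

dot-+ᵥ : ∀ {n} (c x y : Point n) → dot c (x +ᵥ y) ≡ dot c x ℚ.+ dot c y
dot-+ᵥ []       []      []      = refl
dot-+ᵥ (c ∷ cs) (a ∷ x) (b ∷ y) = begin
  c ℚ.* (a ℚ.+ b) ℚ.+ dot cs (x +ᵥ y)               ≡⟨ cong₂ ℚ._+_ (ℚP.*-distribˡ-+ c a b) (dot-+ᵥ cs x y) ⟩
  (c ℚ.* a ℚ.+ c ℚ.* b) ℚ.+ (dot cs x ℚ.+ dot cs y) ≡⟨ interchange (c ℚ.* a) (c ℚ.* b) (dot cs x) (dot cs y) ⟩
  (c ℚ.* a ℚ.+ dot cs x) ℚ.+ (c ℚ.* b ℚ.+ dot cs y) ∎
  where open ≡-Reasoning

dot-0ᵥ : ∀ {n} (c : Point n) → dot c 0ᵥ ≡ 0ℚ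
dot-0ᵥ []       = refl
dot-0ᵥ (c ∷ cs) = cong₂ ℚ._+_ (ℚP.*-zeroʳ c) (dot-0ᵥ cs)

dot-sumᵥ-map : ∀ {A : Set} {n} (c : Point n) (y : A → Point n) (L : List A) →
               dot c (sumᵥ (List.map y L)) ≡ sumℚ (List.map (λ a → dot c (y a)) L)
dot-sumᵥ-map c y []      = dot-0ᵥ c
dot-sumᵥ-map c y (a ∷ L) = trans (dot-+ᵥ c (y a) _) (cong (dot c (y a) ℚ.+_) (dot-sumᵥ-map c y L))

dot-e : ∀ {n} (c : Point n) (i : Fin n) → dot c (e i) ≡ lookup c i
dot-e (c ∷ cs) zero    = trans (cong₂ ℚ._+_ (ℚP.*-identityʳ c) (dot-0ᵥ cs)) (ℚP.+-identityʳ c)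
dot-e (c ∷ cs) (suc i) = trans (cong₂ ℚ._+_ (ℚP.*-zeroʳ c) (dot-e cs i)) (ℚP.+-identityˡ _)

sumℚ-zero : ∀ {n} (y : Point n) → (∀ j → lookup y j ≡ 0ℚ) → sumℚ (toList y) ≡ 0ℚ
sumℚ-zero []      _    = refl
sumℚ-zero (a ∷ y) y≗0 = cong₂ ℚ._+_ (y≗0 zero) (sumℚ-zero y (y≗0 ∘ suc))

sumℚ-supported : ∀ {n} (y : Point n) i → (∀ j → j ≢ i → lookup y j ≡ 0ℚ) → sumℚ (toList y) ≡ lookup y i
sumℚ-supported (a ∷ y) zero    off = trans (cong (a ℚ.+_) (sumℚ-zero y (λ j → off (suc j) λ ()))) (ℚP.+-identityʳ a)
sumℚ-supported (a ∷ y) (suc i) off =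
  trans (cong₂ ℚ._+_ (off zero λ ()) (sumℚ-supported y i (λ j j≢i → off (suc j) (j≢i ∘ FinP.suc-injective))))
        (ℚP.+-identityˡ _)

sumℚ-mono-≤ : ∀ {A : Set} {f g : A → ℚ} (L : List A) → (∀ {a} → a ∈ L → f a ℚ.≤ g a) →
              sumℚ (List.map f L) ℚ.≤ sumℚ (List.map g L)
sumℚ-mono-≤ []      f≤g = ℚP.≤-refl
sumℚ-mono-≤ (a ∷ L) f≤g = ℚP.+-mono-≤ (f≤g (here refl)) (sumℚ-mono-≤ L (f≤g ∘ there))

sumℚ-mono-< : ∀ {A : Set} {f g : A → ℚ} (L : List A) → (∀ {a} → a ∈ L → f a ℚ.≤ g a) →
              ∀ {b} → b ∈ L → f b ℚ.< g b → sumℚ (List.map f L) ℚ.< sumℚ (List.map g L)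
sumℚ-mono-< (a ∷ L) f≤g (here refl) fb<gb = ℚP.+-mono-<-≤ fb<gb (sumℚ-mono-≤ L (f≤g ∘ there))
sumℚ-mono-< (a ∷ L) f≤g (there b∈L) fb<gb = ℚP.+-mono-≤-< (f≤g (here refl)) (sumℚ-mono-< L (f≤g ∘ there) b∈L fb<gb)

-- Linear functionals on a simplex

e∈Δ : ∀ {n} {F : Subset n} {i} → lookup F i ≡ inside → InSimplex F (e i)
e∈Δ {F = F} {i} i∈F = nonneg , sum≡1 i , vanishes
  where
  nonneg : ∀ j → 0ℚ ℚ.≤ lookup (e i) j
  nonneg j with i FinP.≟ j
  ... | yes refl = subst (0ℚ ℚ.≤_) (sym (lookup-e-≡ i)) (ℚP.<⇒≤ (ℚP.positive⁻¹ 1ℚ))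
  ... | no i≢j   = ℚP.≤-reflexive (sym (lookup-e-≢ i≢j))
  sum≡1 : ∀ {n} (i : Fin n) → sumℚ (toList (e i)) ≡ 1ℚ
  sum≡1 i = trans (sumℚ-supported (e i) i (λ j j≢i → lookup-e-≢ (j≢i ∘ sym))) (lookup-e-≡ i)
  vanishes : ∀ j → lookup F j ≡ outside → lookup (e i) j ≡ 0ℚ
  vanishes j j∉F = lookup-e-≢ {i = i} {j} λ { refl → contradiction (trans (sym i∈F) j∉F) λ () }

Δ-supported⇒≡e : ∀ {n} (F : Subset n) {y} i → InSimplex F y → (∀ j → j ≢ i → lookup y j ≡ 0ℚ) → y ≡ e i
Δ-supported⇒≡e F {y} i (_ , sum≡1 , _) off = lookup-ext pointwise
  where
  pointwise : ∀ j → lookup y j ≡ lookup (e i) j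
  pointwise j with j FinP.≟ i
  ... | yes refl = trans (sym (sumℚ-supported y j off)) (trans sum≡1 (sym (lookup-e-≡ j)))
  ... | no j≢i   = trans (off j j≢i) (sym (lookup-e-≢ (j≢i ∘ sym)))

dot≤*sum : ∀ {n} (c y : Point n) M → (∀ i → lookup c i ℚ.* lookup y i ℚ.≤ M ℚ.* lookup y i) →
           dot c y ℚ.≤ M ℚ.* sumℚ (toList y)
dot≤*sum []       []      M _  = ℚP.≤-reflexive (sym (ℚP.*-zeroʳ M))
dot≤*sum (c ∷ cs) (a ∷ y) M cy≤My =
  subst (c ℚ.* a ℚ.+ dot cs y ℚ.≤_) (sym (ℚP.*-distribˡ-+ M a _))
    (ℚP.+-mono-≤ (cy≤My zero) (dot≤*sum cs y M (cy≤My ∘ suc)))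

dot<*sum : ∀ {n} (c y : Point n) M → (∀ i → lookup c i ℚ.* lookup y i ℚ.≤ M ℚ.* lookup y i) →
           ∀ j → lookup c j ℚ.* lookup y j ℚ.< M ℚ.* lookup y j → dot c y ℚ.< M ℚ.* sumℚ (toList y)
dot<*sum (c ∷ cs) (a ∷ y) M cy≤My zero    cy<My =
  subst (c ℚ.* a ℚ.+ dot cs y ℚ.<_) (sym (ℚP.*-distribˡ-+ M a _))
    (ℚP.+-mono-<-≤ cy<My (dot≤*sum cs y M (cy≤My ∘ suc)))
dot<*sum (c ∷ cs) (a ∷ y) M cy≤My (suc j) cy<My =
  subst (c ℚ.* a ℚ.+ dot cs y ℚ.<_) (sym (ℚP.*-distribˡ-+ M a _))
    (ℚP.+-mono-≤-< (cy≤My zero) (dot<*sum cs y M (cy≤My ∘ suc) j cy<My))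

module _ {n} (F : Subset n) {y : Point n} (y∈Δ : InSimplex F y)
         (c : Point n) {M : ℚ} (c≤M : ∀ i → lookup F i ≡ inside → lookup c i ℚ.≤ M) where

  private
    nonneg = proj₁ y∈Δ
    sum≡1  = proj₁ (proj₂ y∈Δ)

    weighted : ∀ i → lookup c i ℚ.* lookup y i ℚ.≤ M ℚ.* lookup y i
    weighted i with lookup F i in i∈F
    ... | true  = ℚP.*-monoʳ-≤-nonNeg (lookup y i) {{ℚ.nonNegative (nonneg i)}} (c≤M i i∈F)
    ... | false rewrite proj₂ (proj₂ y∈Δ) i i∈F = ℚP.≤-reflexive (trans (ℚP.*-zeroʳ (lookup c i)) (sym (ℚP.*-zeroʳ M)))

    scale : M ℚ.* sumℚ (toList y) ≡ M
    scale = trans (cong (M ℚ.*_) sum≡1) (ℚP.*-identityʳ M)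

  dot≤-simplex : dot c y ℚ.≤ M
  dot≤-simplex = subst (dot c y ℚ.≤_) scale (dot≤*sum c y M weighted)

  dot<-simplex : ∀ j → lookup y j ≢ 0ℚ → lookup c j ℚ.< M → dot c y ℚ.< M
  dot<-simplex j yj≢0 cj<M = subst (dot c y ℚ.<_) scale (dot<*sum c y M weighted j cyj<Myj)
    where
    0<yj : 0ℚ ℚ.< lookup y j
    0<yj = ≤∧≢⇒< (nonneg j) (yj≢0 ∘ sym)
    cyj<Myj : lookup c j ℚ.* lookup y j ℚ.< M ℚ.* lookup y j
    cyj<Myj = ℚP.*-monoˡ-<-pos (lookup y j) {{ℚ.positive 0<yj}} cj<M

members : ∀ {n} → Subset n → List (Fin n)
members {n} F = filter (λ i → lookup F i Bool.≟ inside) (allFin n)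

∈members⇒ : ∀ {n} (F : Subset n) {i} → i ∈ members F → lookup F i ≡ inside
∈members⇒ {n} F = proj₂ ∘ ∈-filter⁻ (λ i → lookup F i Bool.≟ inside) {xs = allFin n}

⇒∈members : ∀ {n} (F : Subset n) {i} → lookup F i ≡ inside → i ∈ members F
⇒∈members F {i} = ∈-filter⁺ (λ i → lookup F i Bool.≟ inside) (∈-allFin i)

-- default is a junk value: the top element of the empty subset.
module Top {n} {_≺_ : Rel (Fin n) 0ℓ} (≺-isStrictTotalOrder : IsStrictTotalOrder _≡_ _≺_) (default : Fin n) where

  private
    strictTotalOrder : StrictTotalOrder 0ℓ 0ℓ 0ℓ
    strictTotalOrder = record { isStrictTotalOrder = ≺-isStrictTotalOrder }

  open import Relation.Binary.Properties.StrictTotalOrder strictTotalOrder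
    using (decTotalOrder)
  open DecTotalOrder decTotalOrder public
    using (antisym) renaming (_≤_ to _≼_)
  open import Data.List.Extrema (DecTotalOrder.totalOrder decTotalOrder)
    using (max; argmax-sel; ⊥≤max; xs≤max)

  maxOf : List (Fin n) → Fin n
  maxOf []       = default
  maxOf (i ∷ is) = max i is

  maxOf-∈ : ∀ {xs z} → z ∈ xs → maxOf xs ∈ xs
  maxOf-∈ {i ∷ is} _ with argmax-sel id i is
  ... | inj₁ max≡i  = here max≡i
  ... | inj₂ max∈is = there max∈is

  ≼-maxOf : ∀ {xs z} → z ∈ xs → z ≼ maxOf xs
  ≼-maxOf {i ∷ is} (here refl) = ⊥≤max i is
  ≼-maxOf {i ∷ is} (there z∈is) = All.lookup (xs≤max i is) z∈is

  top : Subset n → Fin n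
  top F = maxOf (members F)

  top-∈ : ∀ F {z} → lookup F z ≡ inside → lookup F (top F) ≡ inside
  top-∈ F z∈F = ∈members⇒ F (maxOf-∈ (⇒∈members F z∈F))

  ≼-top : ∀ F {j} → lookup F j ≡ inside → j ≼ top F
  ≼-top F j∈F = ≼-maxOf (⇒∈members F j∈F)

  top≡⇔ : ∀ F {z i} → lookup F z ≡ inside →
          top F ≡ i ⇔ (lookup F i ≡ inside × (∀ j → lookup F j ≡ inside → j ≼ i))
  top≡⇔ F z∈F = mk⇔
    (λ { refl → top-∈ F z∈F , λ j → ≼-top F })
    (λ (i∈F , ≼i) → antisym (≼i (top F) (top-∈ F i∈F)) (≼-top F i∈F))

indicator : Bool → ℕ
indicator true  = 1
indicator false = 0

count : ∀ {A : Set} → (A → Bool) → List A → ℕ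
count p []       = 0
count p (x ∷ xs) = indicator (p x) + count p xs

count-++ : ∀ {A : Set} (p : A → Bool) xs ys → count p (xs ++ ys) ≡ count p xs + count p ys
count-++ p []       ys = refl
count-++ p (x ∷ xs) ys = trans (cong (indicator (p x) +_) (count-++ p xs ys)) (sym (ℕP.+-assoc (indicator (p x)) _ _))

count-map : ∀ {A B : Set} (p : B → Bool) (f : A → B) xs → count p (List.map f xs) ≡ count (p ∘ f) xs
count-map p f []       = refl
count-map p f (x ∷ xs) = cong (indicator (p (f x)) +_) (count-map p f xs)

count-cong : ∀ {A : Set} {p q : A → Bool} → (∀ x → p x ≡ q x) → ∀ xs → count p xs ≡ count q xs
count-cong p≗q []       = refl
count-cong p≗q (x ∷ xs) = cong₂ _+_ (cong indicator (p≗q x)) (count-cong p≗q xs)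

count-false : ∀ {A : Set} {p : A → Bool} → (∀ x → p x ≡ false) → ∀ xs → count p xs ≡ 0
count-false p≗false []       = refl
count-false p≗false (x ∷ xs) rewrite p≗false x = count-false p≗false xs

count-filter : ∀ {A : Set} {P : A → Set} (P? : ∀ x → Dec (P x)) (p : A → Bool) xs →
               count p (filter P? xs) ≡ count (λ x → does (P? x) ∧ p x) xs
count-filter P? p []       = refl
count-filter P? p (x ∷ xs) with does (P? x)
... | true  = cong (indicator (p x) +_) (count-filter P? p xs)
... | false = count-filter P? p xs

length-filter : ∀ {A : Set} {P : A → Set} (P? : ∀ x → Dec (P x)) xs →
                length (filter P? xs) ≡ count (does ∘ P?) xs
length-filter P? []       = refl
length-filter P? (x ∷ xs) with does (P? x)
... | true  = cong suc (length-filter P? xs)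
... | false = length-filter P? xs

indicator-mono : ∀ {a b} → (T a → T b) → indicator a ≤ indicator b
indicator-mono {false}         _   = z≤n
indicator-mono {true}  {true}  _   = ℕP.≤-refl
indicator-mono {true}  {false} a⇒b = ⊥-elim (a⇒b _)

module ℕSum = CommutativeMonoidSum ℕP.+-0-commutativeMonoid

countFin : ∀ {n} → (Fin n → Bool) → ℕ
countFin f = ℕSum.sum (indicator ∘ f)

countFin-cong : ∀ {n} {f g : Fin n → Bool} → (∀ x → f x ≡ g x) → countFin f ≡ countFin g
countFin-cong f≗g = ℕSum.sum-cong-≗ (cong indicator ∘ f≗g)

countFin-∘-permutation : ∀ {n} (f : Fin n → Bool) (π : Permutation n n) → countFin (f ∘ (π ⟨$⟩ʳ_)) ≡ countFin f
countFin-∘-permutation f π = sym (ℕSum.sum-permute (indicator ∘ f) π)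

countFin-false : ∀ {n} {f : Fin n → Bool} → (∀ x → f x ≡ false) → countFin f ≡ 0
countFin-false {zero}  f≗false = refl
countFin-false {suc n} f≗false rewrite f≗false zero = countFin-false (f≗false ∘ suc)

countFin-true : ∀ n → countFin {n} (λ _ → true) ≡ n
countFin-true zero    = refl
countFin-true (suc n) = cong suc (countFin-true n)

countFin-mono-≤ : ∀ {n} {f g : Fin n → Bool} → (∀ x → T (f x) → T (g x)) → countFin f ≤ countFin g
countFin-mono-≤ {zero}          f⇒g = z≤n
countFin-mono-≤ {suc n} {f} {g} f⇒g = ℕP.+-mono-≤ (indicator-mono (f⇒g zero)) (countFin-mono-≤ (f⇒g ∘ suc))

countFin-mono-< : ∀ {n} {f g : Fin n → Bool} → (∀ x → T (f x) → T (g x)) →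
                  ∀ j → ¬ T (f j) → T (g j) → countFin f < countFin g
countFin-mono-< {suc n} {f} {g} f⇒g zero ¬fj gj with f zero | g zero
... | false | true  = s≤s (countFin-mono-≤ (f⇒g ∘ suc))
... | true  | _     = contradiction _ ¬fj
countFin-mono-< {suc n} {f} {g} f⇒g (suc j) ¬fj gj =
  ℕP.+-mono-≤-< (indicator-mono (f⇒g zero)) (countFin-mono-< (f⇒g ∘ suc) j ¬fj gj)

countFin-toℕ< : ∀ n a → a ≤ n → countFin {n} (λ x → does (toℕ x ℕ.<? a)) ≡ a
countFin-toℕ< n       zero    _         = countFin-false {n} (λ _ → refl)
countFin-toℕ< (suc n) (suc a) (s≤s a≤n) = cong suc (countFin-toℕ< n a a≤n)

countFin-≟ : ∀ {n} (i : Fin n) → countFin (λ x → does (x FinP.≟ i)) ≡ 1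
countFin-≟ {suc n} zero    = cong suc (countFin-false {n} (λ _ → refl))
countFin-≟ {suc n} (suc i) = countFin-≟ i

countEq≡countFin : ∀ {n} v (u : Point n) → countEq v u ≡ countFin (λ i → does (lookup u i ℚP.≟ v))
countEq≡countFin v u = trans (length-filter (ℚP._≟ v) (toList u)) (go u)
  where
  go : ∀ {n} (u : Point n) → count (λ q → does (q ℚP.≟ v)) (toList u) ≡ countFin (λ i → does (lookup u i ℚP.≟ v))
  go []      = refl
  go (x ∷ u) = cong (indicator (does (x ℚP.≟ v)) +_) (go u)

-- Counting subsets subject to membership constraints

data Constraint : Set where
  required forbidden optional : Constraint

allows : Constraint → Bool → Bool
allows required  s = s
allows forbidden s = not s
allows optional  _ = true

isRequired : Constraint → Bool
isRequired required = true
isRequired _        = false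

isOptional : Constraint → Bool
isOptional optional = true
isOptional _        = false

satisfies : ∀ {n} → Vec Constraint n → Subset n → Bool
satisfies []      []      = true
satisfies (c ∷ M) (s ∷ F) = allows c s ∧ satisfies M F

#required #optional : ∀ {n} → Vec Constraint n → ℕ
#required M = countFin (isRequired ∘ lookup M)
#optional M = countFin (isOptional ∘ lookup M)

satisfies⇔ : ∀ {n} (M : Vec Constraint n) F → T (satisfies M F) ⇔ (∀ j → T (allows (lookup M j) (lookup F j)))
satisfies⇔ []      []      = mk⇔ (λ _ ()) (λ _ → _)
satisfies⇔ (c ∷ M) (s ∷ F) = mk⇔
  (λ sat → let cs , MF = Equivalence.to BoolP.T-∧ sat in
     λ { zero → cs ; (suc j) → Equivalence.to (satisfies⇔ M F) MF j })
  (λ all → Equivalence.from BoolP.T-∧ (all zero , Equivalence.from (satisfies⇔ M F) (all ∘ suc)))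

#required≤∣∣ : ∀ {n} (M : Vec Constraint n) F → T (satisfies M F) → #required M ≤ ∣ F ∣
#required≤∣∣ []               []          _   = z≤n
#required≤∣∣ (required  ∷ M) (true  ∷ F) sat = s≤s (#required≤∣∣ M F sat)
#required≤∣∣ (forbidden ∷ M) (false ∷ F) sat = #required≤∣∣ M F sat
#required≤∣∣ (optional  ∷ M) (true  ∷ F) sat = ℕP.m≤n⇒m≤1+n (#required≤∣∣ M F sat)
#required≤∣∣ (optional  ∷ M) (false ∷ F) sat = #required≤∣∣ M F sat

count-allSubsets-suc : ∀ {n} (p : Subset (suc n) → Bool) →
  count p (allSubsets (suc n)) ≡ count (p ∘ (inside ∷_)) (allSubsets n) + count (p ∘ (outside ∷_)) (allSubsets n)
count-allSubsets-suc {n} p = trans (count-++ p (List.map (inside ∷_) S) _) (cong₂ _+_ (count-map p _ S) (count-map p _ S))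
  where S = allSubsets n

-- F must contain the required elements and r of the optional ones.
count-satisfying : ∀ {n} (M : Vec Constraint n) r →
  count (λ F → (∣ F ∣ ≡ᵇ #required M + r) ∧ satisfies M F) (allSubsets n) ≡ #optional M C r
count-satisfying []       zero    = refl
count-satisfying []       (suc r) = refl
count-satisfying {suc n} (required ∷ M) r =
  trans (count-allSubsets-suc {n} _)
    (trans (cong₂ _+_ (count-satisfying M r) (count-false (λ _ → BoolP.∧-zeroʳ _) (allSubsets n)))
           (ℕP.+-identityʳ _))
count-satisfying {suc n} (forbidden ∷ M) r =
  trans (count-allSubsets-suc {n} _)
    (cong₂ _+_ (count-false (λ _ → BoolP.∧-zeroʳ _) (allSubsets n)) (count-satisfying M r))
count-satisfying {suc n} (optional ∷ M) zero =
  trans (count-allSubsets-suc {n} _)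
    (cong₂ _+_ (count-false too-large (allSubsets n)) (count-satisfying M zero))
  where
  too-large : ∀ F → (suc ∣ F ∣ ≡ᵇ #required M + 0) ∧ satisfies M F ≡ false
  too-large F with satisfies M F in sat
  ... | false = BoolP.∧-zeroʳ _
  ... | true  = trans (BoolP.∧-identityʳ _) (dec-false (suc ∣ F ∣ ℕ.≟ #required M + 0) λ eq →
    ℕP.<-irrefl (sym eq) (ℕP.≤-<-trans (ℕP.≤-reflexive (ℕP.+-identityʳ _))
                                       (s≤s (#required≤∣∣ M F (subst T (sym sat) _)))))
count-satisfying {suc n} (optional ∷ M) (suc r) =
  trans (count-allSubsets-suc {n} _)
    (trans (cong₂ _+_ (trans (count-cong shift (allSubsets n)) (count-satisfying M r)) (count-satisfying M (suc r)))
           (nCk+nC[k+1]≡[n+1]C[k+1] (#optional M) r))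
  where
  shift : ∀ F → (suc ∣ F ∣ ≡ᵇ #required M + suc r) ∧ satisfies M F ≡ (∣ F ∣ ≡ᵇ #required M + r) ∧ satisfies M F
  shift F = cong (λ t → (suc ∣ F ∣ ≡ᵇ t) ∧ satisfies M F) (ℕP.+-suc (#required M) r)

injective⇒surjective : ∀ {n} (f : Fin n → Fin n) → (∀ {a b} → f a ≡ f b → a ≡ b) → ∀ y → ∃ λ x → f x ≡ y
injective⇒surjective {suc n} f f-inj y with FinP.any? (λ x → f x FinP.≟ y)
... | yes hit = hit
... | no miss = contradiction (FinP.injective⇒≤ g-inj) ℕP.1+n≰n
  where
  g : Fin (suc n) → Fin n
  g x = punchOut {i = y} {j = f x} (λ y≡fx → miss (x , sym y≡fx))
  g-inj : ∀ {a b} → g a ≡ g b → a ≡ b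
  g-inj {a} {b} = f-inj ∘ FinP.punchOut-injective (λ y≡fa → miss (a , sym y≡fa)) (λ y≡fb → miss (b , sym y≡fb))

injective⇒permutation : ∀ {n} (f : Fin n → Fin n) → (∀ {a b} → f a ≡ f b → a ≡ b) →
                        Σ (Permutation n n) λ π → ∀ i → π ⟨$⟩ʳ i ≡ f i
injective⇒permutation f f-inj =
  permutation f (proj₁ ∘ surj) (proj₂ ∘ surj) (λ x → f-inj (proj₂ (surj (f x)))) , λ _ → refl
  where surj = injective⇒surjective f f-inj

0<nCk : ∀ {n k} → k ≤ n → 0 < n C k
0<nCk {n}     {zero}  _         = s≤s z≤n
0<nCk {suc n} {suc k} (s≤s k≤n) =
  subst (0 <_) (nCk+nC[k+1]≡[n+1]C[k+1] n k) (ℕP.<-≤-trans (0<nCk k≤n) (ℕP.m≤m+n _ _))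

nC[k+1]<mC[k+1] : ∀ {n m} k → suc k ≤ n → n < m → n C suc k < m C suc k
nC[k+1]<mC[k+1] {n} {suc m} k k<n (s≤s n≤m) with ℕP.m≤n⇒m<n∨m≡n n≤m
... | inj₂ refl = subst (n C suc k <_) (trans (ℕP.+-comm (n C suc k) (n C k)) (nCk+nC[k+1]≡[n+1]C[k+1] n k))
                    (ℕP.m<m+n (n C suc k) (0<nCk (ℕP.<⇒≤ k<n)))
... | inj₁ n<m  = subst (n C suc k <_) (nCk+nC[k+1]≡[n+1]C[k+1] m k)
                    (ℕP.<-≤-trans (nC[k+1]<mC[k+1] k k<n n<m) (ℕP.m≤n+m _ _))

nCk≡0⇔n<k : ∀ {n k} → n C k ≡ 0 ⇔ n < k
nCk≡0⇔n<k {n} {k} = mk⇔ to k>n⇒nCk≡0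
  where
  to : n C k ≡ 0 → n < k
  to nCk≡0 with ℕP.<-≤-connex n k
  ... | inj₁ n<k = n<k
  ... | inj₂ k≤n = contradiction nCk≡0 (ℕP.>⇒≢ (0<nCk k≤n))

nC[k+1]≡mC[k+1]⇒n≡m : ∀ {n m} k → suc k ≤ m → n C suc k ≡ m C suc k → n ≡ m
nC[k+1]≡mC[k+1]⇒n≡m {n} {m} k k<m eq with ℕP.<-cmp n m
... | tri≈ _ n≡m _ = n≡m
... | tri> _ _ m<n = contradiction (sym eq) (ℕP.<⇒≢ (nC[k+1]<mC[k+1] k k<m m<n))
... | tri< n<m _ _ with ℕP.<-≤-connex n (suc k)
...   | inj₁ n<k+1 = contradiction (trans (sym (k>n⇒nCk≡0 n<k+1)) eq) (ℕP.<⇒≢ (0<nCk k<m))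
...   | inj₂ k<n   = contradiction eq (ℕP.<⇒≢ (nC[k+1]<mC[k+1] k k<n n<m))

-- Opaque, as the type checker must never unfold ℕ→ℚ (n C k): normalising it is very costly.
opaque
  _Cℚ_ : ℕ → ℕ → ℚ
  n Cℚ k = ℕ→ℚ (n C k)

  Cℚ≡ℕ→ℚC : ∀ n k → n Cℚ k ≡ ℕ→ℚ (n C k)
  Cℚ≡ℕ→ℚC n k = refl

Cℚ≡0⇔n<k : ∀ {n k} → n Cℚ k ≡ 0ℚ ⇔ n < k
Cℚ≡0⇔n<k {n} {k} = nCk≡0⇔n<k ⇔-∘ mk⇔ (ℕ→ℚ-injective ∘ trans (sym (Cℚ≡ℕ→ℚC n k)))
                                         (trans (Cℚ≡ℕ→ℚC n k) ∘ cong ℕ→ℚ)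

nCℚ[k+1]≡mCℚ[k+1]⇒n≡m : ∀ {n m} k → suc k ≤ m → n Cℚ suc k ≡ m Cℚ suc k → n ≡ m
nCℚ[k+1]≡mCℚ[k+1]⇒n≡m {n} {m} k k<m eq =
  nC[k+1]≡mC[k+1]⇒n≡m k k<m (ℕ→ℚ-injective (trans (sym (Cℚ≡ℕ→ℚC n (suc k))) (trans eq (Cℚ≡ℕ→ℚC m (suc k)))))

-- Opaque for the same reason.
opaque
  vertexOf : ∀ {n} → ℕ → Permutation n n → Point n
  vertexOf K π = tabulate (λ i → toℕ (π ⟨$⟩ʳ i) Cℚ K)

  lookup-vertexOf : ∀ {n} K (π : Permutation n n) i → lookup (vertexOf K π) i ≡ toℕ (π ⟨$⟩ʳ i) Cℚ K
  lookup-vertexOf K π = VecP.lookup∘tabulate _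

-- The vertex picked out by a strict total order

∈kSubsets⇒∣∣≡ : ∀ {n k F} → F ∈ kSubsets n k → ∣ F ∣ ≡ k
∈kSubsets⇒∣∣≡ {n} {k} = proj₂ ∘ ∈-filter⁻ (λ F → ∣ F ∣ ℕ.≟ k) {xs = allSubsets n}

nonempty : ∀ {n} (F : Subset n) → 1 ≤ ∣ F ∣ → ∃ λ z → lookup F z ≡ inside
nonempty (true  ∷ F) _   = zero , refl
nonempty (false ∷ F) 1≤∣F∣ = let z , z∈F = nonempty F 1≤∣F∣ in suc z , z∈F

lookup-e-indicator : ∀ {n} (j i : Fin n) → lookup (e j) i ≡ ℕ→ℚ (indicator (does (j FinP.≟ i)))
lookup-e-indicator j i with j FinP.≟ i
... | yes refl = lookup-e-≡ j
... | no  j≢i  = lookup-e-≢ j≢i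

lookup-sumᵥ-e : ∀ {A : Set} {n} (f : A → Fin n) L i →
                lookup (sumᵥ (List.map (e ∘ f) L)) i ≡ ℕ→ℚ (count (λ a → does (f a FinP.≟ i)) L)
lookup-sumᵥ-e f L i = trans (lookup-sumᵥ-map (e ∘ f) L i) (go L)
  where
  go : ∀ L → sumℚ (List.map (λ a → lookup (e (f a)) i) L) ≡ ℕ→ℚ (count (λ a → does (f a FinP.≟ i)) L)
  go []      = refl
  go (a ∷ L) = trans (cong₂ ℚ._+_ (lookup-e-indicator (f a) i) (go L))
                     (sym (ℕ→ℚ-+ (indicator (does (f a FinP.≟ i))) (count (λ a → does (f a FinP.≟ i)) L)))

module MaxVertex {n} {_≺_ : Rel (Fin n) 0ℓ} (≺-isStrictTotalOrder : IsStrictTotalOrder _≡_ _≺_)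
                 (default : Fin n) (K : ℕ) where

  open Top ≺-isStrictTotalOrder default public
  open IsStrictTotalOrder ≺-isStrictTotalOrder
    using () renaming (_<?_ to _≺?_; irrefl to ≺-irrefl; trans to ≺-trans; compare to ≺-compare)

  v : Point n
  v = sumᵥ (List.map (e ∘ top) (kSubsets n (suc K)))

  v∈Π : InPi n (suc K) v
  v∈Π = e ∘ top , (λ F ∣F∣≡k → e∈Δ {F = F} (top-∈ F (proj₂ (nonempty F (subst (1 ≤_) (sym ∣F∣≡k) (s≤s z≤n)))))) , refl

  rank : Fin n → ℕ
  rank i = countFin (λ j → does (j ≺? i))

  private
    T⇒≺ : ∀ {j i} → T (does (j ≺? i)) → j ≺ i
    T⇒≺ {j} {i} t with j ≺? i
    ... | yes j≺i = j≺i

    ≺⇒T : ∀ {j i} → j ≺ i → T (does (j ≺? i))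
    ≺⇒T {j} {i} j≺i with j ≺? i
    ... | yes _   = _
    ... | no  j⊀i = j⊀i j≺i

  constraintBelow : Fin n → Fin n → Constraint
  constraintBelow i j with j FinP.≟ i | j ≺? i
  ... | yes _ | _     = required
  ... | no  _ | yes _ = optional
  ... | no  _ | no  _ = forbidden

  below : Fin n → Vec Constraint n
  below i = tabulate (constraintBelow i)

  #required-below : ∀ i → #required (below i) ≡ 1
  #required-below i = trans (countFin-cong pointwise) (countFin-≟ i)
    where
    pointwise : ∀ j → isRequired (lookup (below i) j) ≡ does (j FinP.≟ i)
    pointwise j rewrite VecP.lookup∘tabulate (constraintBelow i) j with j FinP.≟ i | j ≺? i
    ... | yes _ | _     = refl
    ... | no  _ | yes _ = refl
    ... | no  _ | no  _ = refl

  #optional-below : ∀ i → #optional (below i) ≡ rank i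
  #optional-below i = countFin-cong pointwise
    where
    pointwise : ∀ j → isOptional (lookup (below i) j) ≡ does (j ≺? i)
    pointwise j rewrite VecP.lookup∘tabulate (constraintBelow i) j with j FinP.≟ i | j ≺? i
    ... | yes refl | yes i≺i = contradiction i≺i (≺-irrefl refl)
    ... | yes _    | no  _   = refl
    ... | no  _    | yes _   = refl
    ... | no  _    | no  _   = refl

  satisfies-below⇔ : ∀ i F → T (satisfies (below i) F) ⇔ (lookup F i ≡ inside × (∀ j → lookup F j ≡ inside → j ≼ i))
  satisfies-below⇔ i F = mk⇔ to from
    where
    allowsAt : (∀ j → T (allows (lookup (below i) j) (lookup F j))) ⇔ (∀ j → T (allows (constraintBelow i j) (lookup F j)))
    allowsAt = mk⇔ (λ h j → subst (λ c → T (allows c (lookup F j))) (VecP.lookup∘tabulate _ j) (h j))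
                   (λ h j → subst (λ c → T (allows c (lookup F j))) (sym (VecP.lookup∘tabulate _ j)) (h j))
    to : T (satisfies (below i) F) → _
    to sat = i∈F , ≼i
      where
      at = Equivalence.to allowsAt (Equivalence.to (satisfies⇔ (below i) F) sat)
      i∈F : lookup F i ≡ inside
      i∈F with i FinP.≟ i | i ≺? i | at i
      ... | yes _  | _ | ok = Equivalence.to BoolP.T-≡ ok
      ... | no i≢i | _ | _  = contradiction refl i≢i
      ≼i : ∀ j → lookup F j ≡ inside → j ≼ i
      ≼i j j∈F with j FinP.≟ i | j ≺? i | at j
      ... | yes j≡i | _       | _  = inj₂ j≡i
      ... | no  _   | yes j≺i | _  = inj₁ j≺i
      ... | no  _   | no  _   | ok rewrite j∈F = ⊥-elim ok
    from : _ → T (satisfies (below i) F)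
    from (i∈F , ≼i) = Equivalence.from (satisfies⇔ (below i) F) (Equivalence.from allowsAt at)
      where
      at : ∀ j → T (allows (constraintBelow i j) (lookup F j))
      at j with j FinP.≟ i | j ≺? i
      ... | yes refl | _       = Equivalence.from BoolP.T-≡ i∈F
      ... | no  _    | yes _   = _
      ... | no  j≢i  | no  j⊀i with lookup F j in j∈F
      ...   | false = _
      ...   | true with ≼i j j∈F
      ...     | inj₁ j≺i = j⊀i j≺i
      ...     | inj₂ j≡i = j≢i j≡i

  count-top≡ : ∀ i → count (λ F → does (top F FinP.≟ i)) (kSubsets n (suc K)) ≡ rank i C K
  count-top≡ i = begin
      count (λ F → does (top F FinP.≟ i)) (kSubsets n (suc K))
    ≡⟨ count-filter (λ F → ∣ F ∣ ℕ.≟ suc K) _ (allSubsets n) ⟩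
      count (λ F → (∣ F ∣ ≡ᵇ suc K) ∧ does (top F FinP.≟ i)) (allSubsets n)
    ≡⟨ count-cong top≡i⇔satisfies (allSubsets n) ⟩
      count (λ F → (∣ F ∣ ≡ᵇ 1 + K) ∧ satisfies (below i) F) (allSubsets n)
    ≡⟨ cong (λ m → count (λ F → (∣ F ∣ ≡ᵇ m + K) ∧ satisfies (below i) F) (allSubsets n)) (#required-below i) ⟨
      count (λ F → (∣ F ∣ ≡ᵇ #required (below i) + K) ∧ satisfies (below i) F) (allSubsets n)
    ≡⟨ count-satisfying (below i) K ⟩
      #optional (below i) C K
    ≡⟨ cong (_C K) (#optional-below i) ⟩
      rank i C K ∎
    where
    open ≡-Reasoning
    top≡i⇔satisfies : ∀ F → (∣ F ∣ ≡ᵇ suc K) ∧ does (top F FinP.≟ i) ≡ (∣ F ∣ ≡ᵇ suc K) ∧ satisfies (below i) F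
    top≡i⇔satisfies F with ∣ F ∣ ≡ᵇ suc K in ∣F∣≡ᵇk
    ... | false = refl
    ... | true  = does-⇔ (⇔-sym (satisfies-below⇔ i F) ⇔-∘ top≡⇔ F z∈F) (top F FinP.≟ i) (T? (satisfies (below i) F))
      where
      z∈F = proj₂ (nonempty F (subst (1 ≤_) (sym (ℕP.≡ᵇ⇒≡ _ _ (subst T (sym ∣F∣≡ᵇk) _))) (s≤s z≤n)))

  lookup-v : ∀ i → lookup v i ≡ rank i Cℚ K
  lookup-v i = trans (lookup-sumᵥ-e top (kSubsets n (suc K)) i) (trans (cong ℕ→ℚ (count-top≡ i)) (sym (Cℚ≡ℕ→ℚC (rank i) K)))

  rank-mono : ∀ {i j} → j ≺ i → rank j < rank i
  rank-mono {i} {j} j≺i = countFin-mono-< (λ x x≺j → ≺⇒T (≺-trans (T⇒≺ x≺j) j≺i)) j (≺-irrefl refl ∘ T⇒≺) (≺⇒T j≺i)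

  rank<n : ∀ i → rank i < n
  rank<n i = subst (rank i <_) (countFin-true n) (countFin-mono-< (λ _ _ → _) i (≺-irrefl refl ∘ T⇒≺) _)

  rank-injective : ∀ {i j} → rank i ≡ rank j → i ≡ j
  rank-injective {i} {j} eq with ≺-compare i j
  ... | tri< i≺j _ _ = contradiction eq (ℕP.<⇒≢ (rank-mono i≺j))
  ... | tri≈ _ i≡j _ = i≡j
  ... | tri> _ _ j≺i = contradiction (sym eq) (ℕP.<⇒≢ (rank-mono j≺i))

  rankPermutation : Σ (Permutation n n) λ π → ∀ i → toℕ (π ⟨$⟩ʳ i) ≡ rank i
  rankPermutation =
    let π , π≗ = injective⇒permutation (λ i → fromℕ< (rank<n i)) rank-injective′
    in π , λ i → trans (cong toℕ (π≗ i)) (FinP.toℕ-fromℕ< (rank<n i))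
    where
    rank-injective′ : ∀ {i j} → fromℕ< (rank<n i) ≡ fromℕ< (rank<n j) → i ≡ j
    rank-injective′ {i} {j} eq =
      rank-injective (trans (sym (FinP.toℕ-fromℕ< (rank<n i))) (trans (cong toℕ eq) (FinP.toℕ-fromℕ< (rank<n j))))

  rank-permutation : (π : Permutation n n) → (∀ {i j} → j ≺ i ⇔ π ⟨$⟩ʳ j Fin.< π ⟨$⟩ʳ i) →
                     ∀ i → rank i ≡ toℕ (π ⟨$⟩ʳ i)
  rank-permutation π ≺⇔< i = begin
      rank i
    ≡⟨ countFin-cong (λ j → does-⇔ ≺⇔< (j ≺? i) (toℕ (π ⟨$⟩ʳ j) ℕ.<? toℕ (π ⟨$⟩ʳ i))) ⟩
      countFin (below-πi ∘ (π ⟨$⟩ʳ_))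
    ≡⟨ countFin-∘-permutation below-πi π ⟩
      countFin below-πi
    ≡⟨ countFin-toℕ< n (toℕ (π ⟨$⟩ʳ i)) (ℕP.<⇒≤ (FinP.toℕ<n _)) ⟩
      toℕ (π ⟨$⟩ʳ i) ∎
    where
    open ≡-Reasoning
    below-πi : Fin n → Bool
    below-πi x = does (toℕ x ℕ.<? toℕ (π ⟨$⟩ʳ i))

  v≡vertexOf : ∀ (π : Permutation n n) → (∀ i → toℕ (π ⟨$⟩ʳ i) ≡ rank i) → v ≡ vertexOf K π
  v≡vertexOf π π≗rank = lookup-ext λ i →
    trans (lookup-v i) (sym (trans (lookup-vertexOf K π i) (cong (_Cℚ K) (π≗rank i))))

-- Maximizing a linear functional over Π

Lex : ∀ {n} → Point n → Rel (Fin n) 0ℓ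
Lex c j i = ×-Lex _≡_ ℚ._<_ Fin._<_ (lookup c j , j) (lookup c i , i)

Lex-isStrictTotalOrder : ∀ {n} (c : Point n) → IsStrictTotalOrder _≡_ (Lex c)
Lex-isStrictTotalOrder c = isStrictTotalOrderᶜ record
  { isEquivalence = isEquivalence
  ; trans         = λ {a} {b} {d} →
      ×-transitive isEquivalence ℚP.<-resp-≡ ℚP.<-trans FinP.<-trans {lookup c a , a} {lookup c b , b} {lookup c d , d}
  ; compare       = compare
  }
  where
  compare : ∀ a b → _
  compare a b with ×-compare sym ℚP.<-cmp FinP.<-cmp (lookup c a , a) (lookup c b , b)
  ... | tri< a≺b a≉b b⊀a       = tri< a≺b (λ { refl → a≉b (refl , refl) }) b⊀a
  ... | tri≈ a⊀b (_ , a≡b) b⊀a = tri≈ a⊀b a≡b b⊀a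
  ... | tri> a⊀b a≉b b≺a       = tri> a⊀b (λ { refl → a≉b (refl , refl) }) b≺a

Lex⇔< : ∀ {n} (c : Point n) → (∀ {i j} → lookup c i ≡ lookup c j → i ≡ j) →
        ∀ {i j} → Lex c j i ⇔ lookup c j ℚ.< lookup c i
Lex⇔< c c-inj = mk⇔ (λ { (inj₁ cj<ci) → cj<ci ; (inj₂ (cj≡ci , j<i)) → contradiction (c-inj cj≡ci) (FinP.<⇒≢ j<i) }) inj₁

module Maximize {n} (c : Point n) (default : Fin n) (K : ℕ) where

  open MaxVertex (Lex-isStrictTotalOrder c) default K public

  private
    L = kSubsets n (suc K)

  c≤top : ∀ F j → lookup F j ≡ inside → lookup c j ℚ.≤ lookup c (top F)
  c≤top F j j∈F with ≼-top F j∈F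
  ... | inj₁ (inj₁ cj<ct)      = ℚP.<⇒≤ cj<ct
  ... | inj₁ (inj₂ (cj≡ct , _)) = ℚP.≤-reflexive cj≡ct
  ... | inj₂ refl              = ℚP.≤-refl

  dot≤top : ∀ F {y} → InSimplex F y → dot c y ℚ.≤ lookup c (top F)
  dot≤top F y∈Δ = dot≤-simplex F y∈Δ c (c≤top F)

  dot<top : (∀ {i j} → lookup c i ≡ lookup c j → i ≡ j) →
            ∀ F {y} → InSimplex F y → y ≢ e (top F) → dot c y ℚ.< lookup c (top F)
  dot<top c-inj F {y} y∈Δ y≢e with FinP.any? (λ j → ¬? (j FinP.≟ top F) ×-dec ¬? (lookup y j ℚP.≟ 0ℚ))
  ... | yes (j , j≢t , yj≢0) = dot<-simplex F y∈Δ c (c≤top F) j yj≢0 (≤∧≢⇒< (c≤top F j j∈F) (j≢t ∘ c-inj))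
    where
    j∈F : lookup F j ≡ inside
    j∈F with lookup F j in j∉F
    ... | true  = refl
    ... | false = contradiction (proj₂ (proj₂ y∈Δ) j j∉F) yj≢0
  ... | no none = contradiction (Δ-supported⇒≡e F (top F) y∈Δ off) y≢e
    where
    off : ∀ j → j ≢ top F → lookup y j ≡ 0ℚ
    off j j≢t with lookup y j ℚP.≟ 0ℚ
    ... | yes yj≡0 = yj≡0
    ... | no  yj≢0 = contradiction (j , j≢t , yj≢0) none

  dot-v : dot c v ≡ sumℚ (List.map (lookup c ∘ top) L)
  dot-v = trans (dot-sumᵥ-map c (e ∘ top) L) (cong sumℚ (ListP.map-cong (dot-e c ∘ top) L))

  dot≤dot-v : ∀ {x} → InPi n (suc K) x → dot c x ℚ.≤ dot c v
  dot≤dot-v (y , y∈Δ , refl) =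
    subst₂ ℚ._≤_ (sym (dot-sumᵥ-map c y L)) (sym dot-v)
      (sumℚ-mono-≤ L (λ {F} F∈L → dot≤top F (y∈Δ F (∈kSubsets⇒∣∣≡ F∈L))))

  dot<dot-v : (∀ {i j} → lookup c i ≡ lookup c j → i ≡ j) →
              ∀ {x} → InPi n (suc K) x → x ≢ v → dot c x ℚ.< dot c v
  dot<dot-v c-inj (y , y∈Δ , refl) x≢v with All.all? (λ F → VecP.≡-dec ℚP._≟_ (y F) (e (top F))) L
  ... | yes y≗e∘top = contradiction (cong sumᵥ (ListP.map-cong-local y≗e∘top)) x≢v
  ... | no ¬y≗e∘top with find (¬All⇒Any¬ (λ F → VecP.≡-dec ℚP._≟_ (y F) (e (top F))) L ¬y≗e∘top)
  ...   | F , F∈L , yF≢e =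
    subst₂ ℚ._<_ (sym (dot-sumᵥ-map c y L)) (sym dot-v)
      (sumℚ-mono-< L (λ {F} F∈L → dot≤top F (y∈Δ F (∈kSubsets⇒∣∣≡ F∈L))) F∈L
        (dot<top c-inj F (y∈Δ F (∈kSubsets⇒∣∣≡ F∈L)) yF≢e))

  maximizer≡v : ∀ {u} → InPi n (suc K) u → (∀ x → InPi n (suc K) x → x ≢ u → dot c x ℚ.< dot c u) → u ≡ v
  maximizer≡v {u} u∈Π u-max with VecP.≡-dec ℚP._≟_ u v
  ... | yes u≡v = u≡v
  ... | no  u≢v = contradiction (ℚP.<-≤-trans (u-max v v∈Π (u≢v ∘ sym)) (dot≤dot-v u∈Π)) (ℚP.<-irrefl refl)

isVertex⇒≡vertexOf : ∀ {n} (default : Fin n) K {u} → IsVertex (InPi n (suc K)) u → ∃ λ π → u ≡ vertexOf K π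
isVertex⇒≡vertexOf default K (u∈Π , c , u-max) =
  π , trans (maximizer≡v u∈Π u-max) (v≡vertexOf π π≗rank)
  where
  open Maximize c default K
  π = proj₁ rankPermutation
  π≗rank = proj₂ rankPermutation

permutationWeights : ∀ {n} → Permutation n n → Point n
permutationWeights π = tabulate (λ i → ℕ→ℚ (toℕ (π ⟨$⟩ʳ i)))

⟨$⟩ʳ-injective : ∀ {n} (π : Permutation n n) {i j} → π ⟨$⟩ʳ i ≡ π ⟨$⟩ʳ j → i ≡ j
⟨$⟩ʳ-injective π πi≡πj = trans (sym (Perm.inverseˡ π)) (trans (cong (π ⟨$⟩ˡ_) πi≡πj) (Perm.inverseˡ π))

vertexOf-isVertex : ∀ {n} (default : Fin n) K (π : Permutation n n) → IsVertex (InPi n (suc K)) (vertexOf K π)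
vertexOf-isVertex {n} default K π = subst (InPi n (suc K)) v≡π v∈Π , c , maximizes
  where
  c = permutationWeights π
  open Maximize c default K

  lookup-c : ∀ i → lookup c i ≡ ℕ→ℚ (toℕ (π ⟨$⟩ʳ i))
  lookup-c = VecP.lookup∘tabulate _

  c-inj : ∀ {i j} → lookup c i ≡ lookup c j → i ≡ j
  c-inj {i} {j} ci≡cj =
    ⟨$⟩ʳ-injective π (FinP.toℕ-injective (ℕ→ℚ-injective (trans (sym (lookup-c i)) (trans ci≡cj (lookup-c j)))))

  ≺⇔< : ∀ {i j} → Lex c j i ⇔ π ⟨$⟩ʳ j Fin.< π ⟨$⟩ʳ i
  ≺⇔< {i} {j} = mk⇔ (ℕ→ℚ-cancel-< ∘ subst₂ ℚ._<_ (lookup-c j) (lookup-c i))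
                    (subst₂ ℚ._<_ (sym (lookup-c j)) (sym (lookup-c i)) ∘ ℕ→ℚ-mono-<)
                ⇔-∘ Lex⇔< c c-inj

  v≡π : v ≡ vertexOf K π
  v≡π = v≡vertexOf π (sym ∘ rank-permutation π ≺⇔<)

  maximizes : ∀ x → InPi n (suc K) x → x ≢ vertexOf K π → dot c x ℚ.< dot c (vertexOf K π)
  maximizes x x∈Π x≢π = subst (λ u → dot c x ℚ.< dot c u) v≡π (dot<dot-v c-inj x∈Π (λ x≡v → x≢π (trans x≡v v≡π)))

lookup-vertexOf-cases : ∀ {N} K (π : Permutation N N) i →
  lookup (vertexOf K π) i ≡ 0ℚ ⊎ ∃ λ m → K ≤ m × m < N × lookup (vertexOf K π) i ≡ m Cℚ K
lookup-vertexOf-cases K π i with ℕP.<-≤-connex (toℕ (π ⟨$⟩ʳ i)) K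
... | inj₁ πi<K = inj₁ (trans (lookup-vertexOf K π i) (Equivalence.from Cℚ≡0⇔n<k πi<K))
... | inj₂ K≤πi = inj₂ (toℕ (π ⟨$⟩ʳ i) , K≤πi , FinP.toℕ<n _ , lookup-vertexOf K π i)

countEq-vertexOf : ∀ {N} K (π : Permutation N N) v →
  countEq v (vertexOf K π) ≡ countFin {N} (λ r → does (toℕ r Cℚ K ℚP.≟ v))
countEq-vertexOf {N} K π v = begin
    countEq v (vertexOf K π)
  ≡⟨ countEq≡countFin v (vertexOf K π) ⟩
    countFin (λ i → does (lookup (vertexOf K π) i ℚP.≟ v))
  ≡⟨ countFin-cong (λ i → cong (λ q → does (q ℚP.≟ v)) (lookup-vertexOf K π i)) ⟩
    countFin (hasValue ∘ (π ⟨$⟩ʳ_))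
  ≡⟨ countFin-∘-permutation hasValue π ⟩
    countFin hasValue ∎
  where
  open ≡-Reasoning
  hasValue : Fin N → Bool
  hasValue r = does (toℕ r Cℚ K ℚP.≟ v)

countEq-0-vertexOf : ∀ {N} K (π : Permutation N N) → K ≤ N → countEq 0ℚ (vertexOf K π) ≡ K
countEq-0-vertexOf {N} K π K≤N =
  trans (countEq-vertexOf K π 0ℚ)
    (trans (countFin-cong {N} (λ r → does-⇔ Cℚ≡0⇔n<k (toℕ r Cℚ K ℚP.≟ 0ℚ) (toℕ r ℕ.<? K)))
           (countFin-toℕ< N K K≤N))

countEq-C-vertexOf : ∀ {N} k (π : Permutation N N) {m} → suc k ≤ m → (m<N : m < N) →
                     countEq (m Cℚ suc k) (vertexOf (suc k) π) ≡ 1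
countEq-C-vertexOf {N} k π {m} k<m m<N =
  trans (countEq-vertexOf (suc k) π _)
    (trans (countFin-cong {N} (λ r → does-⇔ same-value⇔ (toℕ r Cℚ suc k ℚP.≟ m Cℚ suc k) (r FinP.≟ fromℕ< m<N)))
           (countFin-≟ (fromℕ< m<N)))
  where
  same-value⇔ : ∀ {r} → toℕ r Cℚ suc k ≡ m Cℚ suc k ⇔ r ≡ fromℕ< m<N
  same-value⇔ = mk⇔
    (λ eq → FinP.toℕ-injective (trans (nCℚ[k+1]≡mCℚ[k+1]⇒n≡m k k<m eq) (sym (FinP.toℕ-fromℕ< m<N))))
    (λ { refl → cong (_Cℚ suc k) (FinP.toℕ-fromℕ< m<N) })

-- Listing the vertices

length-cartesianProductWith : ∀ {A B C : Set} (f : A → B → C) xs ys →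
                              length (cartesianProductWith f xs ys) ≡ length xs * length ys
length-cartesianProductWith f []       ys = refl
length-cartesianProductWith f (x ∷ xs) ys =
  trans (ListP.length-++ (List.map (f x) ys)) (cong₂ _+_ (ListP.length-map (f x) ys) (length-cartesianProductWith f xs ys))

Unique-map⁺ : ∀ {A B : Set} {f : A → B} {xs} → (∀ {x y} → x ∈ xs → y ∈ xs → f x ≡ f y → x ≡ y) →
              Unique xs → Unique (List.map f xs)
Unique-map⁺ {xs = []}             _   []           = []
Unique-map⁺ {f = f} {xs = x ∷ xs} inj (x∉xs ∷ xs!) =
  All.tabulate (λ fy∈fxs fx≡fy → let y , y∈xs , eq = ∈-map⁻ f fy∈fxs in
                                 All.lookup x∉xs y∈xs (inj (here refl) (there y∈xs) (trans fx≡fy eq)))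
  ∷ Unique-map⁺ (λ x∈ y∈ → inj (there x∈) (there y∈)) xs!

Unique-cartesianProductWith⁺ : ∀ {A B C : Set} (f : A → B → C) xs ys →
  (∀ {x x′ y y′} → x ∈ xs → x′ ∈ xs → y ∈ ys → y′ ∈ ys → f x y ≡ f x′ y′ → x ≡ x′ × y ≡ y′) →
  Unique xs → Unique ys → Unique (cartesianProductWith f xs ys)
Unique-cartesianProductWith⁺ f []       ys inj _            _   = []
Unique-cartesianProductWith⁺ f (x ∷ xs) ys inj (x∉xs ∷ xs!) ys! =
  ++⁺ (Unique-map⁺ (λ y∈ y′∈ eq → proj₂ (inj (here refl) (here refl) y∈ y′∈ eq)) ys!)
      (Unique-cartesianProductWith⁺ f xs ys (λ x∈ x′∈ → inj (there x∈) (there x′∈)) xs! ys!)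
      disjoint
  where
  disjoint : ∀ {z} → ¬ (z ∈ List.map (f x) ys × z ∈ cartesianProductWith f xs ys)
  disjoint (z∈fxys , z∈rest) =
    let y , y∈ys , z≡fxy = ∈-map⁻ (f x) z∈fxys
        x′ , y′ , x′∈xs , y′∈ys , z≡fx′y′ = ∈-cartesianProductWith⁻ f xs ys z∈rest
    in All.lookup x∉xs x′∈xs (proj₁ (inj (here refl) (there x′∈xs) y∈ys y′∈ys (trans (sym z≡fxy) z≡fx′y′)))

insertAt-injective : ∀ {A : Set} {n} {w w′ : Vec A n} {p p′ x} → (∀ q → lookup w′ q ≢ x) →
                     insertAt w p x ≡ insertAt w′ p′ x → p ≡ p′ × w ≡ w′
insertAt-injective {w = w} {w′} {p} {p′} {x} x∉w′ eq with p FinP.≟ p′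
... | yes refl = refl , (begin
    w                       ≡⟨ VecP.removeAt-insertAt w p x ⟨
    removeAt (insertAt w p x) p ≡⟨ cong (λ v → removeAt v p) eq ⟩
    removeAt (insertAt w′ p x) p ≡⟨ VecP.removeAt-insertAt w′ p x ⟩
    w′                      ∎)
  where open ≡-Reasoning
... | no  p≢p′ = contradiction x-in-w′ (x∉w′ q)
  where
  q = punchOut (p≢p′ ∘ sym)
  x-in-w′ : lookup w′ q ≡ x
  x-in-w′ = begin
      lookup w′ q                          ≡⟨ VecP.insertAt-punchIn w′ p′ x q ⟨
      lookup (insertAt w′ p′ x) (punchIn p′ q) ≡⟨ cong (lookup (insertAt w′ p′ x)) (FinP.punchIn-punchOut (p≢p′ ∘ sym)) ⟩
      lookup (insertAt w′ p′ x) p          ≡⟨ cong (λ v → lookup v p) eq ⟨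
      lookup (insertAt w p x) p            ≡⟨ VecP.insertAt-lookup w p x ⟩
      x                                    ∎
    where open ≡-Reasoning

insert-⟨$⟩ʳ-at : ∀ {m} (i j : Fin (suc m)) (π : Permutation m m) → Perm.insert i j π ⟨$⟩ʳ i ≡ j
insert-⟨$⟩ʳ-at i j π with i FinP.≟ i
... | yes _   = refl
... | no  i≢i = contradiction refl i≢i

toℕ-punchIn-fromℕ : ∀ m (x : Fin m) → toℕ (punchIn (fromℕ m) x) ≡ toℕ x
toℕ-punchIn-fromℕ (suc m) zero    = refl
toℕ-punchIn-fromℕ (suc m) (suc x) = cong suc (toℕ-punchIn-fromℕ m x)

vertexOf-cong : ∀ {n} K {π ρ : Permutation n n} → (∀ i → π ⟨$⟩ʳ i ≡ ρ ⟨$⟩ʳ i) → vertexOf K π ≡ vertexOf K ρ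
vertexOf-cong K {π} {ρ} π≗ρ = lookup-ext λ i →
  trans (lookup-vertexOf K π i) (trans (cong (λ r → toℕ r Cℚ K) (π≗ρ i)) (sym (lookup-vertexOf K ρ i)))

insertAt-vertexOf : ∀ {m} K (p : Fin (suc m)) (π : Permutation m m) →
                    insertAt (vertexOf K π) p (m Cℚ K) ≡ vertexOf K (Perm.insert p (fromℕ m) π)
insertAt-vertexOf {m} K p π = lookup-ext pointwise
  where
  π⁺ = Perm.insert p (fromℕ m) π
  pointwise : ∀ q → lookup (insertAt (vertexOf K π) p (m Cℚ K)) q ≡ lookup (vertexOf K π⁺) q
  pointwise q with p FinP.≟ q
  ... | yes refl = begin
      lookup (insertAt (vertexOf K π) p (m Cℚ K)) p ≡⟨ VecP.insertAt-lookup (vertexOf K π) p _ ⟩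
      m Cℚ K                                       ≡⟨ cong (_Cℚ K) (FinP.toℕ-fromℕ m) ⟨
      toℕ (fromℕ m) Cℚ K                           ≡⟨ cong (λ r → toℕ r Cℚ K) (insert-⟨$⟩ʳ-at p (fromℕ m) π) ⟨
      toℕ (π⁺ ⟨$⟩ʳ p) Cℚ K                         ≡⟨ lookup-vertexOf K π⁺ p ⟨
      lookup (vertexOf K π⁺) p                     ∎
    where open ≡-Reasoning
  ... | no p≢q with q′ ← punchOut p≢q | refl ← FinP.punchIn-punchOut p≢q = begin
      lookup (insertAt (vertexOf K π) p (m Cℚ K)) (punchIn p q′) ≡⟨ VecP.insertAt-punchIn (vertexOf K π) p _ q′ ⟩
      lookup (vertexOf K π) q′                                 ≡⟨ lookup-vertexOf K π q′ ⟩
      toℕ (π ⟨$⟩ʳ q′) Cℚ K                                     ≡⟨ cong (_Cℚ K) (toℕ-punchIn-fromℕ m _) ⟨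
      toℕ (punchIn (fromℕ m) (π ⟨$⟩ʳ q′)) Cℚ K                 ≡⟨ cong (λ r → toℕ r Cℚ K) (Perm.insert-punchIn p (fromℕ m) π q′) ⟨
      toℕ (π⁺ ⟨$⟩ʳ punchIn p q′) Cℚ K                          ≡⟨ lookup-vertexOf K π⁺ (punchIn p q′) ⟨
      lookup (vertexOf K π⁺) (punchIn p q′)                    ∎
    where open ≡-Reasoning

HasVertexCoordinates : ∀ n k → Point n → Set
HasVertexCoordinates n k u =
  ((i : Fin n) → lookup u i ≡ 0ℚ ⊎ ∃ λ m → (k ∸ 1 ≤ m) × (m ≤ n ∸ 1) × (lookup u i ≡ ℕ→ℚ (m C (k ∸ 1))))
  × countEq 0ℚ u ≡ k ∸ 1
  × ((m : ℕ) → k ∸ 1 ≤ m → m ≤ n ∸ 1 → countEq (ℕ→ℚ (m C (k ∸ 1))) u ≡ 1)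

VertexList : ℕ → ℕ → Set
VertexList n k = Σ (List (Point n)) λ L →
  Unique L × ((u : Point n) → (u ∈ L) ⇔ IsVertex (InPi n k) u) × length L ≡ vertexCount n k

*k!≡n!⇒≡vertexCount : ∀ n k {l} → l * k ! ≡ n ! → l ≡ vertexCount n (suc k)
*k!≡n!⇒≡vertexCount n k {l} l*k!≡n! =
  sym (trans (cong (λ t → ℕ._/_ t (k !) {{k ℕP.!≢0}}) (sym l*k!≡n!)) (m*n/n≡m l (k !) {{k ℕP.!≢0}}))

module Enumeration (k : ℕ) where

  insertTop : ∀ j → Fin (suc (j + suc k)) → Point (j + suc k) → Point (suc (j + suc k))
  insertTop j p w = insertAt w p ((j + suc k) Cℚ suc k)

  vertices : ∀ j → List (Point (j + suc k))
  vertices zero    = 0ᵥ ∷ []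
  vertices (suc j) = cartesianProductWith (insertTop j) (allFin (suc (j + suc k))) (vertices j)

  vertexOf≡0ᵥ : (π : Permutation (suc k) (suc k)) → vertexOf (suc k) π ≡ 0ᵥ
  vertexOf≡0ᵥ π = lookup-ext λ i →
    trans (lookup-vertexOf (suc k) π i) (trans (Equivalence.from Cℚ≡0⇔n<k (FinP.toℕ<n (π ⟨$⟩ʳ i))) (sym (VecP.lookup-replicate i 0ℚ)))

  ∈vertices⇒ : ∀ j {u} → u ∈ vertices j → ∃ λ π → u ≡ vertexOf (suc k) π
  ∈vertices⇒ zero    (here refl) = Perm.id , sym (vertexOf≡0ᵥ Perm.id)
  ∈vertices⇒ (suc j) u∈ =
    let p , w , _ , w∈ , u≡ = ∈-cartesianProductWith⁻ (insertTop j) (allFin (suc (j + suc k))) (vertices j) u∈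
        π , w≡π = ∈vertices⇒ j w∈
    in Perm.insert p (fromℕ _) π , trans u≡ (trans (cong (λ x → insertTop j p x) w≡π) (insertAt-vertexOf (suc k) p π))

  vertexOf∈vertices : ∀ j (π : Permutation (j + suc k) (j + suc k)) → vertexOf (suc k) π ∈ vertices j
  vertexOf∈vertices zero    π = here (vertexOf≡0ᵥ π)
  vertexOf∈vertices (suc j) π = subst (_∈ vertices (suc j)) inserted
    (∈-cartesianProductWith⁺ (insertTop j) (∈-allFin p) (vertexOf∈vertices j (Perm.remove p π)))
    where
    p = π ⟨$⟩ˡ fromℕ (j + suc k)
    inserted : insertTop j p (vertexOf (suc k) (Perm.remove p π)) ≡ vertexOf (suc k) π
    inserted = begin
        insertTop j p (vertexOf (suc k) (Perm.remove p π))
      ≡⟨ insertAt-vertexOf (suc k) p (Perm.remove p π) ⟩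
        vertexOf (suc k) (Perm.insert p (fromℕ (j + suc k)) (Perm.remove p π))
      ≡⟨ vertexOf-cong (suc k) (λ i → cong (λ t → Perm.insert p t (Perm.remove p π) ⟨$⟩ʳ i) (Perm.inverseʳ π {fromℕ (j + suc k)})) ⟨
        vertexOf (suc k) (Perm.insert p (π ⟨$⟩ʳ p) (Perm.remove p π))
      ≡⟨ vertexOf-cong (suc k) (Perm.insert-remove p π) ⟩
        vertexOf (suc k) π ∎
      where open ≡-Reasoning

  entry≢top : ∀ j {w} → w ∈ vertices j → ∀ q → lookup w q ≢ (j + suc k) Cℚ suc k
  entry≢top j w∈ q wq≡top with ∈vertices⇒ j w∈
  ... | π , refl = ℕP.<⇒≢ (FinP.toℕ<n (π ⟨$⟩ʳ q))
    (nCℚ[k+1]≡mCℚ[k+1]⇒n≡m k (ℕP.m≤n+m (suc k) j) (trans (sym (lookup-vertexOf (suc k) π q)) wq≡top))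

  vertices-unique : ∀ j → Unique (vertices j)
  vertices-unique zero    = All.[] ∷ []
  vertices-unique (suc j) =
    Unique-cartesianProductWith⁺ (insertTop j) _ (vertices j) (λ _ _ _ w′∈ → insertAt-injective (entry≢top j w′∈)) (allFin⁺ _) (vertices-unique j)

  length-vertices : ∀ j → length (vertices j) * suc k ! ≡ (j + suc k) !
  length-vertices zero    = ℕP.+-identityʳ _
  length-vertices (suc j) = begin
      length (vertices (suc j)) * suc k !
    ≡⟨ cong (_* suc k !) (length-cartesianProductWith (insertTop j) (allFin _) (vertices j)) ⟩
      (length (allFin (suc (j + suc k))) * length (vertices j)) * suc k !
    ≡⟨ cong (λ l → (l * length (vertices j)) * suc k !) (ListP.length-tabulate {n = suc (j + suc k)} id) ⟩
      (suc (j + suc k) * length (vertices j)) * suc k !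
    ≡⟨ ℕP.*-assoc (suc (j + suc k)) (length (vertices j)) (suc k !) ⟩
      suc (j + suc k) * (length (vertices j) * suc k !)
    ≡⟨ cong (suc (j + suc k) *_) (length-vertices j) ⟩
      suc (j + suc k) * (j + suc k) ! ∎
    where open ≡-Reasoning

  ∈vertices⇒isVertex : ∀ j (default : Fin (j + suc k)) {u} → u ∈ vertices j → IsVertex (InPi (j + suc k) (suc (suc k))) u
  ∈vertices⇒isVertex j default u∈ =
    let π , u≡π = ∈vertices⇒ j u∈ in subst (IsVertex (InPi (j + suc k) (suc (suc k)))) (sym u≡π) (vertexOf-isVertex default (suc k) π)

  isVertex⇒∈vertices : ∀ j (default : Fin (j + suc k)) {u} → IsVertex (InPi (j + suc k) (suc (suc k))) u → u ∈ vertices j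
  isVertex⇒∈vertices j default u-vertex =
    let π , u≡π = isVertex⇒≡vertexOf default (suc k) u-vertex in subst (_∈ vertices j) (sym u≡π) (vertexOf∈vertices j π)

  vertexList : ∀ j → VertexList (j + suc k) (suc (suc k))
  vertexList j = vertices j , vertices-unique j , (λ u → mk⇔ (∈vertices⇒isVertex j default) (isVertex⇒∈vertices j default)) ,
                 *k!≡n!⇒≡vertexCount (j + suc k) (suc k) (length-vertices j)
    where
    default : Fin (j + suc k)
    default = fromℕ< (ℕP.m≤n+m (suc k) j)

vertexOf-coordinates : ∀ {n} k (π : Permutation (suc n) (suc n)) → suc k ≤ suc n →
                       HasVertexCoordinates (suc n) (suc (suc k)) (vertexOf (suc k) π)
vertexOf-coordinates k π k+1≤n+1 =
  (λ i → Sum.map₂ (λ (m , k+1≤m , m<n+1 , eq) → m , k+1≤m , ℕP.≤-pred m<n+1 , trans eq (Cℚ≡ℕ→ℚC m (suc k)))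
                  (lookup-vertexOf-cases (suc k) π i)) ,
  countEq-0-vertexOf (suc k) π k+1≤n+1 ,
  λ m k+1≤m m≤n → subst (λ q → countEq q (vertexOf (suc k) π) ≡ 1) (Cℚ≡ℕ→ℚC m (suc k))
                        (countEq-C-vertexOf k π k+1≤m (s≤s m≤n))

proposition2p3 : (n k : ℕ) → 2 ≤ k → k ≤ n →
    ((u : Point n) → IsVertex (InPi n k) u →
      ((i : Fin n) → lookup u i ≡ 0ℚ
          ⊎ ∃ λ m → (k ∸ 1 ≤ m) × (m ≤ n ∸ 1) × (lookup u i ≡ ℕ→ℚ (m C (k ∸ 1))))
      × countEq 0ℚ u ≡ k ∸ 1
      × ((m : ℕ) → k ∸ 1 ≤ m → m ≤ n ∸ 1 → countEq (ℕ→ℚ (m C (k ∸ 1))) u ≡ 1))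
    × (Σ (List (Point n)) λ L →
        Unique L × ((u : Point n) → (u ∈ L) ⇔ IsVertex (InPi n k) u) × length L ≡ vertexCount n k)
proposition2p3 (suc n) (suc (suc k)) (s≤s (s≤s z≤n)) (s≤s k<n) = coordinates , list
  where
  k+1≤n+1 : suc k ≤ suc n
  k+1≤n+1 = ℕP.m≤n⇒m≤1+n k<n

  coordinates : ∀ u → IsVertex (InPi (suc n) (suc (suc k))) u → HasVertexCoordinates (suc n) (suc (suc k)) u
  coordinates u u-vertex =
    let π , u≡π = isVertex⇒≡vertexOf zero (suc k) u-vertex
    in subst (HasVertexCoordinates (suc n) (suc (suc k))) (sym u≡π) (vertexOf-coordinates k π k+1≤n+1)

  list : VertexList (suc n) (suc (suc k))
  list = subst (λ m → VertexList m (suc (suc k))) (ℕP.m∸n+n≡m k+1≤n+1) (Enumeration.vertexList k (suc n ∸ suc k))
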